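{- Let $k\ge1$ and let $\mathcal{F}\subseteq 2^{[n]}$ be a family containing no chain of $k+1$ sets. If $\mathcal{F}$ contains a set of size $i<n/2$, then \[|\mathcal{F}|\le \Sigma(n,k)-\frac{\binom{n}{\lfloor\frac{n-k}{2}\rfloor}}{\binom{n}{i}}+1.\]
   Context: $\Sigma(n,k)=\sum_{i=1}^k\binom{n}{\lfloor\frac{n-k}{2}\rfloor+i}$, the sum of the $k$ largest binomial coefficients of order $n$. A chain of sets is a family totally ordered by inclusion. -}

module Defs where

open import Data.Nat using (ℕ; zero; suc; _+_)
open import Data.Nat.Combinatorics using (_C_)
open import Data.Integer as ℤ using (ℤ; +_; -[1+_])
open import Data.Integer.DivMod using (_/ℕ_)
open import Data.Fin using (Fin)
open import Data.Fin.Subset using (Subset; _⊆_)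
open import Data.List using (List)
open import Data.List.Membership.Propositional using (_∈_)
open import Data.List.Relation.Unary.Unique.Propositional using (Unique)
open import Data.Vec using (Vec; lookup)
open import Data.Sum using (_⊎_)
open import Data.Product using (_×_)
open import Relation.Binary.PropositionalEquality using (_≡_; _≢_)

-- binomial coefficient with an integer lower index (0 outside [0,n])
-- (n C j = 0 for j > n in the stdlib)
binomℤ : ℕ → ℤ → ℕ
binomℤ n (+ j)     = n C j
binomℤ n -[1+ _ ]  = 0

-- ⌊(n-k)/2⌋ as an integer (floor division; divisor positive)
lowIdx : ℕ → ℕ → ℤ
lowIdx n k = (+ n ℤ.- + k) /ℕ 2

Σsum : ℕ → ℕ → ℕ → ℕ
Σsum n k zero    = 0
Σsum n k (suc i) = Σsum n k i + binomℤ n (lowIdx n k ℤ.+ + suc i)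

Σ : ℕ → ℕ → ℕ
Σ n k = Σsum n k k

-- a family of subsets of [n]: a duplicate-free list of subsets
Family : ℕ → Set
Family n = List (Subset n)

IsChainIn : ∀ {n m} → Family n → Vec (Subset n) m → Set
IsChainIn {n} {m} F c =
  ((a : Fin m) → lookup c a ∈ F) ×
  ((a b : Fin m) → a ≢ b → lookup c a ≢ lookup c b) ×
  ((a b : Fin m) → (lookup c a ⊆ lookup c b) ⊎ (lookup c b ⊆ lookup c a))

NoChainOfSize : ∀ {n} → ℕ → Family n → Set
NoChainOfSize {n} m F = (c : Vec (Subset n) m) → IsChainIn F c → Data.Empty.⊥
  where import Data.Empty

-- Write c_j = C(n, j) and m = C(n, ⌊(n − k)/2⌋), and weigh B ⊆ [n] by n!/c_|B| = |B|! (n − |B|)!,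
-- the number of maximal chains of 2^[n] through B.  LYM for families without (k+1)-chains
-- (total weight ≤ k · n!) goes by induction on n: a maximal chain through B ≠ [n] passes through
-- exactly one coatom [n] ∖ {x}, so the weight of F splits over the families of members avoiding x,
-- which inherit the chain condition, with one link fewer when [n] ∈ F.  Each level of a family is
-- an antichain, so has at most c_j members, and g (1 − m/c) ≤ (c − m)⁺ for g ≤ c then gives
-- |G| ≤ m · Σ_{B∈G} 1/c_|B| + Σ_j (c_j − m)⁺.  By unimodality the c_j exceeding m lie among the
-- k middle coefficients, so Σ_j (c_j − m)⁺ = Σ(n,k) − k m.  Applied to G = F ∖ {A}, together with
-- LYM for F, this yields |F| ≤ 1 + m (k − 1/c_i) + Σ(n,k) − k m.
module Submission where

open import Defs
open import Data.Nat.Base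
open import Data.Nat.Properties
open import Algebra.Properties.CommutativeMonoid.Sum +-0-commutativeMonoid
  using (sum; sum-syntax; ∑-distrib-+; sum-cong-≗; sum-replicate-zero)
open import Algebra.Properties.CommutativeSemigroup +-commutativeSemigroup
  using () renaming (interchange to +-interchange)
open import Algebra.Properties.CommutativeSemigroup *-commutativeSemigroup
  using () renaming (x∙yz≈y∙xz to *-left-comm)
open import Data.Bool using (true; false; if_then_else_)
import Data.Bool.Properties as Bool
open import Data.Empty using (⊥-elim)
open import Data.Fin using (Fin; zero; suc)
open import Data.Fin.Subset using (Subset; _⊆_; ∣_∣; ⊤; ∁; inside; outside)
open import Data.Fin.Subset.Properties
  using (⊆-refl; ⊆⊤; drop-∷-⊆; out⊆; p⊆q⇒∣p∣≤∣q∣; ∣p∣≤n; ∣⊤∣≡n; ∣∁p∣≡n∸∣p∣; ∣p∣≡n⇒p≡⊤)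
open import Data.Integer as ℤ using (ℤ; +_; -[1+_])
open import Data.Integer.DivMod using (_/ℕ_)
open import Data.Integer.Properties using (m-n≡m⊖n; ⊖-≥; ⊖-<; [1+m]⊖[1+n]≡m⊖n)
open import Data.List using (List; []; _∷_; filter; length)
import Data.List as List
open import Data.List.Membership.Propositional using (_∈_; _∉_)
open import Data.List.Membership.Propositional.Properties using (∈-map⁻; ∈-filter⁻)
open import Data.List.Properties using (filter-all; map-∘; map-id-local)
open import Data.List.Relation.Binary.Permutation.Propositional
  using (_↭_; ↭-refl; ↭-prep; ↭-swap; ↭-trans; ↭-reflexive)
import Data.List.Relation.Binary.Permutation.Propositional.Properties as ↭
open import Data.List.Relation.Unary.All using (All; []; _∷_)
import Data.List.Relation.Unary.All as All
open import Data.List.Relation.Unary.All.Properties using (all-filter)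
open import Data.List.Relation.Unary.Any using (here; there; any?)
open import Data.List.Relation.Unary.Unique.Propositional using (Unique; []; _∷_)
import Data.List.Relation.Unary.Unique.Propositional.Properties as Unique
open import Data.Nat.Combinatorics
  using (_C_; nCk≡n!/k![n-k]!; k![n∸k]!∣n!; nCk≡nC[n∸k]; [n-k]*d[k+1]≡[k+1]*d[k]; [n-k]*[n-k-1]!≡[n-k]!)
open import Data.Nat.DivMod
  using (_/_; _%_; m/n*n≡m; m/n*n≤m; m≡m%n+[m/n]*n; m%n<n; m/n≤m; m/n<m; m/n≡1+[m∸n]/n)
open import Data.Nat.ListAction using () renaming (sum to sumᴸ)
open import Data.Nat.ListAction.Properties using (sum-↭)
open import Data.Nat.Tactic.RingSolver using (solve-∀)
open import Data.Product using (∃; _×_; _,_; proj₁; proj₂)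
open import Data.Sum using (_⊎_; inj₁; inj₂; [_,_])
import Data.Sum as Sum
open import Data.Vec using (Vec; []; _∷_; lookup; insertAt; removeAt)
import Data.Vec as Vec
import Data.Vec.Base as VecBase
open import Data.Vec.Properties using (≡-dec; lookup-map; insertAt-removeAt; removeAt-insertAt)
open import Function using (_∘_)
open import Relation.Binary.Definitions using (DecidableEquality)
open import Relation.Binary.PropositionalEquality hiding ([_])
open import Relation.Nullary using (Dec; ¬?; yes; no; does; contradiction)
open import Relation.Nullary.Decidable using (dec-true; dec-false)

-- Sums over initial segments of ℕ

sumBelow : ℕ → (ℕ → ℕ) → ℕ
sumBelow zero    g = 0
sumBelow (suc N) g = sumBelow N g + g N

syntax sumBelow N (λ j → e) = ∑ℕ[ j < N ] e

sumBelow-cong : ∀ N {f g : ℕ → ℕ} → (∀ {j} → j < N → f j ≡ g j) → sumBelow N f ≡ sumBelow N g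
sumBelow-cong zero    f≡g = refl
sumBelow-cong (suc N) f≡g = cong₂ _+_ (sumBelow-cong N (f≡g ∘ m<n⇒m<1+n)) (f≡g (n<1+n N))

sumBelow-mono-≤ : ∀ N {f g : ℕ → ℕ} → (∀ {j} → j < N → f j ≤ g j) → sumBelow N f ≤ sumBelow N g
sumBelow-mono-≤ zero    f≤g = z≤n
sumBelow-mono-≤ (suc N) f≤g = +-mono-≤ (sumBelow-mono-≤ N (f≤g ∘ m<n⇒m<1+n)) (f≤g (n<1+n N))

sumBelow-zero : ∀ N {g : ℕ → ℕ} → (∀ {j} → j < N → g j ≡ 0) → sumBelow N g ≡ 0
sumBelow-zero zero    g≡0 = refl
sumBelow-zero (suc N) g≡0 = cong₂ _+_ (sumBelow-zero N (g≡0 ∘ m<n⇒m<1+n)) (g≡0 (n<1+n N))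

sumBelow-const : ∀ N c → ∑ℕ[ j < N ] c ≡ N * c
sumBelow-const zero    c = refl
sumBelow-const (suc N) c = trans (cong (_+ c) (sumBelow-const N c)) (+-comm (N * c) c)

sumBelow-distrib-+ : ∀ N (f g : ℕ → ℕ) → ∑ℕ[ j < N ] (f j + g j) ≡ sumBelow N f + sumBelow N g
sumBelow-distrib-+ zero    f g = refl
sumBelow-distrib-+ (suc N) f g =
  trans (cong (_+ (f N + g N)) (sumBelow-distrib-+ N f g)) (+-interchange (sumBelow N f) _ _ _)

*-distribˡ-sumBelow : ∀ N c (f : ℕ → ℕ) → c * sumBelow N f ≡ ∑ℕ[ j < N ] (c * f j)
*-distribˡ-sumBelow zero    c f = *-zeroʳ c
*-distribˡ-sumBelow (suc N) c f =
  trans (*-distribˡ-+ c (sumBelow N f) (f N)) (cong (_+ c * f N) (*-distribˡ-sumBelow N c f))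

sumBelow-split : ∀ a b (g : ℕ → ℕ) → sumBelow (a + b) g ≡ sumBelow a g + ∑ℕ[ s < b ] g (a + s)
sumBelow-split a zero    g = trans (cong (λ N → sumBelow N g) (+-identityʳ a)) (sym (+-identityʳ _))
sumBelow-split a (suc b) g = begin
  sumBelow (a + suc b) g                            ≡⟨ cong (λ N → sumBelow N g) (+-suc a b) ⟩
  sumBelow (a + b) g + g (a + b)                    ≡⟨ cong (_+ g (a + b)) (sumBelow-split a b g) ⟩
  sumBelow a g + ∑ℕ[ s < b ] g (a + s) + g (a + b)  ≡⟨ +-assoc (sumBelow a g) _ _ ⟩
  sumBelow a g + ∑ℕ[ s < suc b ] g (a + s)          ∎
  where open ≡-Reasoning

sumBelow-mono-range : ∀ {a b} (g : ℕ → ℕ) → a ≤ b → sumBelow a g ≤ sumBelow b g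
sumBelow-mono-range {a} {b} g a≤b = begin
  sumBelow a g                              ≤⟨ m≤m+n (sumBelow a g) _ ⟩
  sumBelow a g + ∑ℕ[ s < b ∸ a ] g (a + s)  ≡⟨ sumBelow-split a (b ∸ a) g ⟨
  sumBelow (a + (b ∸ a)) g                  ≡⟨ cong (λ N → sumBelow N g) (m+[n∸m]≡n a≤b) ⟩
  sumBelow b g                              ∎
  where open ≤-Reasoning

sumBelow-window : ∀ {N} a k {g : ℕ → ℕ} → a + k ≤ N → (∀ {j} → j < N → j < a ⊎ a + k ≤ j → g j ≡ 0) →
                  sumBelow N g ≡ ∑ℕ[ s < k ] g (a + s)
sumBelow-window {N} a k {g} a+k≤N off≡0 = begin
  sumBelow N g                                    ≡⟨ cong (λ M → sumBelow M g) (m+[n∸m]≡n a+k≤N) ⟨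
  sumBelow (a + k + r) g                          ≡⟨ sumBelow-split (a + k) r g ⟩
  sumBelow (a + k) g + ∑ℕ[ s < r ] g (a + k + s)  ≡⟨ cong₂ _+_ (sumBelow-split a k g) (sumBelow-zero r after) ⟩
  sumBelow a g + ∑ℕ[ s < k ] g (a + s) + 0        ≡⟨ cong (λ x → x + ∑ℕ[ s < k ] g (a + s) + 0) (sumBelow-zero a before) ⟩
  0 + ∑ℕ[ s < k ] g (a + s) + 0                   ≡⟨ +-identityʳ _ ⟩
  ∑ℕ[ s < k ] g (a + s)                           ∎
  where
  open ≡-Reasoning
  r : ℕ
  r = N ∸ (a + k)
  before : ∀ {j} → j < a → g j ≡ 0
  before j<a = off≡0 (<-≤-trans j<a (m+n≤o⇒m≤o a a+k≤N)) (inj₁ j<a)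
  after : ∀ {s} → s < r → g (a + k + s) ≡ 0
  after s<r = off≡0 (subst (a + k + _ <_) (m+[n∸m]≡n a+k≤N) (+-monoʳ-< (a + k) s<r)) (inj₂ (m≤m+n (a + k) _))

sumBelow-indicator : ∀ {N a} (h : ℕ → ℕ) → a < N → ∑ℕ[ j < N ] (if does (a ≟ j) then h j else 0) ≡ h a
sumBelow-indicator {suc N} {a} h a<1+N with a ≟ N
... | yes refl = cong₂ _+_ (sumBelow-zero a (λ {j} j<a → cong (if_then h j else 0) (dec-false (a ≟ j) (>⇒≢ j<a))))
                           (cong (if_then h a else 0) (dec-true (a ≟ a) refl))
... | no a≢N   = trans (cong₂ _+_ (sumBelow-indicator h (≤∧≢⇒< (≤-pred a<1+N) a≢N))
                                  (cong (if_then h N else 0) (dec-false (a ≟ N) a≢N)))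
                       (+-identityʳ (h a))

-- Binomial coefficients

nCk*k![n∸k]!≡n! : ∀ {n k} → k ≤ n → (n C k) * (k ! * (n ∸ k) !) ≡ n !
nCk*k![n∸k]!≡n! {n} {k} k≤n =
  trans (cong (_* (k ! * (n ∸ k) !)) (nCk≡n!/k![n-k]! k≤n)) (m/n*n≡m {{k !* (n ∸ k) !≢0}} (k![n∸k]!∣n! k≤n))

nCk*[n∸k]≡nC[1+k]*[1+k] : ∀ {n k} → k < n → (n C k) * (n ∸ k) ≡ (n C suc k) * suc k
nCk*[n∸k]≡nC[1+k]*[1+k] {n} {k} k<n = *-cancelʳ-≡ _ _ d[1+k] {{suc k !* (n ∸ suc k) !≢0}} (begin
  (n C k) * (n ∸ k) * d[1+k]      ≡⟨ *-assoc (n C k) (n ∸ k) d[1+k] ⟩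
  (n C k) * ((n ∸ k) * d[1+k])    ≡⟨ cong ((n C k) *_) ([n-k]*d[k+1]≡[k+1]*d[k] k<n) ⟩
  (n C k) * (suc k * d[k])        ≡⟨ *-left-comm (n C k) (suc k) d[k] ⟩
  suc k * ((n C k) * d[k])        ≡⟨ cong (suc k *_) (nCk*k![n∸k]!≡n! (<⇒≤ k<n)) ⟩
  suc k * n !                     ≡⟨ cong (suc k *_) (nCk*k![n∸k]!≡n! k<n) ⟨
  suc k * ((n C suc k) * d[1+k])  ≡⟨ *-assoc (suc k) (n C suc k) d[1+k] ⟨
  suc k * (n C suc k) * d[1+k]    ≡⟨ cong (_* d[1+k]) (*-comm (suc k) (n C suc k)) ⟩
  (n C suc k) * suc k * d[1+k]    ∎)
  where
  open ≡-Reasoning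
  d[k] d[1+k] : ℕ
  d[k]   = k ! * (n ∸ k) !
  d[1+k] = suc k ! * (n ∸ suc k) !

nCk≤nC[1+k] : ∀ {n k} → suc k + k ≤ n → n C k ≤ n C suc k
nCk≤nC[1+k] {n} {k} [1+k]+k≤n = *-cancelʳ-≤ _ _ (suc k) (begin
  (n C k) * suc k      ≤⟨ *-monoʳ-≤ (n C k) (m+n≤o⇒m≤o∸n (suc k) [1+k]+k≤n) ⟩
  (n C k) * (n ∸ k)    ≡⟨ nCk*[n∸k]≡nC[1+k]*[1+k] (m+n≤o⇒m≤o (suc k) [1+k]+k≤n) ⟩
  (n C suc k) * suc k  ∎)
  where open ≤-Reasoning

nCa≤nCb-lowerHalf : ∀ {n a b} → a ≤ b → b + b ≤ suc n → n C a ≤ n C b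
nCa≤nCb-lowerHalf a≤b b+b≤1+n with m≤n⇒m<n∨m≡n a≤b
... | inj₂ refl = ≤-refl
nCa≤nCb-lowerHalf {n} {a} {suc b} _ [1+b]+[1+b]≤1+n | inj₁ (s≤s a≤b) =
  ≤-trans (nCa≤nCb-lowerHalf a≤b (m≤n⇒m≤1+n (≤-trans (+-monoʳ-≤ b (n≤1+n b)) b+[1+b]≤n)))
          (nCk≤nC[1+k] (subst (_≤ n) (+-suc b b) b+[1+b]≤n))
  where
  b+[1+b]≤n : b + suc b ≤ n
  b+[1+b]≤n = ≤-pred [1+b]+[1+b]≤1+n

nCa≤nCb : ∀ {n a b} → a ≤ b → a + b ≤ n → n C a ≤ n C b
nCa≤nCb {n} {a} {b} a≤b a+b≤n with b + b ≤? suc n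
... | yes b+b≤1+n = nCa≤nCb-lowerHalf a≤b b+b≤1+n
... | no b+b≰1+n = begin
  n C a        ≤⟨ nCa≤nCb-lowerHalf (m+n≤o⇒m≤o∸n a a+b≤n) [n∸b]+[n∸b]≤1+n ⟩
  n C (n ∸ b)  ≡⟨ nCk≡nC[n∸k] b≤n ⟨
  n C b        ∎
  where
  open ≤-Reasoning
  b≤n : b ≤ n
  b≤n = m+n≤o⇒n≤o a a+b≤n
  n∸b≤b : n ∸ b ≤ b
  n∸b≤b = m≤n+o⇒m∸n≤o n b (≤-trans (n≤1+n n) (<⇒≤ (≰⇒> b+b≰1+n)))
  [n∸b]+[n∸b]≤1+n : (n ∸ b) + (n ∸ b) ≤ suc n
  [n∸b]+[n∸b]≤1+n = m≤n⇒m≤1+n (≤-trans (+-monoʳ-≤ (n ∸ b) n∸b≤b) (≤-reflexive (m∸n+n≡m b≤n)))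

nCb≤nCa : ∀ {n a b} → a ≤ b → b ≤ n → n ≤ a + b → n C b ≤ n C a
nCb≤nCa {n} {a} {b} a≤b b≤n n≤a+b = begin
  n C b        ≡⟨ nCk≡nC[n∸k] b≤n ⟩
  n C (n ∸ b)  ≤⟨ nCa≤nCb (m≤n+o⇒m∸n≤o n b (subst (n ≤_) (+-comm a b) n≤a+b))
                          (≤-trans (+-monoʳ-≤ (n ∸ b) a≤b) (≤-reflexive (m∸n+n≡m b≤n))) ⟩
  n C a        ∎
  where open ≤-Reasoning

-- Subsets, chains and families

module Removal {a} {A : Set a} (_≟_ : DecidableEquality A) where

  _∖_ : List A → A → List A
  xs ∖ x = filter (λ y → ¬? (y ≟ x)) xs

  ∈-∖⁻ : ∀ {x y xs} → y ∈ xs ∖ x → y ∈ xs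
  ∈-∖⁻ {x} {xs = xs} = proj₁ ∘ ∈-filter⁻ (λ y → ¬? (y ≟ x)) {xs = xs}

  x∉xs∖x : ∀ {x xs} → x ∉ xs ∖ x
  x∉xs∖x {x} {xs} x∈ = proj₂ (∈-filter⁻ (λ y → ¬? (y ≟ x)) {xs = xs} x∈) refl

  ∖-unique : ∀ {x xs} → Unique xs → Unique (xs ∖ x)
  ∖-unique {x} = Unique.filter⁺ (λ y → ¬? (y ≟ x))

  ↭-∖ : ∀ {x xs} → Unique xs → x ∈ xs → xs ↭ x ∷ (xs ∖ x)
  ↭-∖ {x} {y ∷ ys} (y≢ys ∷ ys-unique) x∈y∷ys with y ≟ x
  ... | yes refl =
    ↭-prep y (↭-reflexive (sym (filter-all (λ z → ¬? (z ≟ y)) (All.map (λ y≢z → y≢z ∘ sym) y≢ys))))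
  ... | no y≢x with x∈y∷ys
  ...   | here x≡y   = contradiction (sym x≡y) y≢x
  ...   | there x∈ys = ↭-trans (↭-prep y (↭-∖ ys-unique x∈ys)) (↭-swap y x ↭-refl)

_≟ˢ_ : ∀ {n} → DecidableEquality (Subset n)
_≟ˢ_ = ≡-dec Bool._≟_

module _ {n : ℕ} where
  open Removal (_≟ˢ_ {n}) public

embed : ∀ {n} → Fin (suc n) → Subset n → Subset (suc n)
embed x p = insertAt p x outside

∣embed∣ : ∀ {n} (x : Fin (suc n)) (p : Subset n) → ∣ embed x p ∣ ≡ ∣ p ∣
∣embed∣ zero    p             = refl
∣embed∣ (suc x) (inside ∷ p)  = cong suc (∣embed∣ x p)
∣embed∣ (suc x) (outside ∷ p) = ∣embed∣ x p

embed-injective : ∀ {n} (x : Fin (suc n)) {p q : Subset n} → embed x p ≡ embed x q → p ≡ q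
embed-injective x {p} {q} eq =
  trans (sym (removeAt-insertAt p x outside)) (trans (cong (λ r → removeAt r x) eq) (removeAt-insertAt q x outside))

embed-mono : ∀ {n} (x : Fin (suc n)) {p q : Subset n} → p ⊆ q → embed x p ⊆ embed x q
embed-mono zero    p⊆q = out⊆ p⊆q
embed-mono (suc x) {_ ∷ _} {_ ∷ _} p⊆q VecBase.here with p⊆q VecBase.here
... | VecBase.here = VecBase.here
embed-mono (suc x) {_ ∷ _} {_ ∷ _} p⊆q (VecBase.there y∈p) = VecBase.there (embed-mono x (drop-∷-⊆ p⊆q) y∈p)

embed≢⊤ : ∀ {n} (x : Fin (suc n)) (p : Subset n) → embed x p ≢ ⊤
embed≢⊤ {n} x p eq =
  <⇒≢ (s≤s (∣p∣≤n p)) (trans (sym (∣embed∣ x p)) (trans (cong ∣_∣ eq) (∣⊤∣≡n (suc n))))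

embed-removeAt : ∀ {n} (p : Subset (suc n)) (x : Fin (suc n)) → lookup p x ≡ outside → embed x (removeAt p x) ≡ p
embed-removeAt p x p[x]≡outside = trans (cong (insertAt (removeAt p x) x) (sym p[x]≡outside)) (insertAt-removeAt p x)

∣removeAt∣ : ∀ {n} (p : Subset (suc n)) (x : Fin (suc n)) → lookup p x ≡ outside → ∣ removeAt p x ∣ ≡ ∣ p ∣
∣removeAt∣ p x p[x]≡outside = trans (sym (∣embed∣ x (removeAt p x))) (cong ∣_∣ (embed-removeAt p x p[x]≡outside))

p⊆q∧∣p∣≡∣q∣⇒p≡q : ∀ {n} {p q : Subset n} → p ⊆ q → ∣ p ∣ ≡ ∣ q ∣ → p ≡ q
p⊆q∧∣p∣≡∣q∣⇒p≡q {p = []}          {[]}          _   _ = refl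
p⊆q∧∣p∣≡∣q∣⇒p≡q {p = inside ∷ p}  {inside ∷ q}  p⊆q e =
  cong (inside ∷_) (p⊆q∧∣p∣≡∣q∣⇒p≡q (drop-∷-⊆ p⊆q) (suc-injective e))
p⊆q∧∣p∣≡∣q∣⇒p≡q {p = outside ∷ p} {outside ∷ q} p⊆q e =
  cong (outside ∷_) (p⊆q∧∣p∣≡∣q∣⇒p≡q (drop-∷-⊆ p⊆q) e)
p⊆q∧∣p∣≡∣q∣⇒p≡q {p = outside ∷ p} {inside ∷ q}  p⊆q e =
  contradiction (p⊆q⇒∣p∣≤∣q∣ (drop-∷-⊆ p⊆q)) (<⇒≱ (≤-reflexive (sym e)))
p⊆q∧∣p∣≡∣q∣⇒p≡q {p = inside ∷ p}  {outside ∷ q} p⊆q e with p⊆q VecBase.here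
... | ()

IsChainIn-map : ∀ {n n′ m} {G : Family n} {F : Family n′} {c : Vec (Subset n) m} (f : Subset n → Subset n′) →
                (∀ {p q} → f p ≡ f q → p ≡ q) → (∀ {p q} → p ⊆ q → f p ⊆ f q) → (∀ {B} → B ∈ G → f B ∈ F) →
                IsChainIn G c → IsChainIn F (Vec.map f c)
IsChainIn-map {F = F} {c} f f-injective f-mono G↪F (c∈G , c-distinct , c-comparable) =
  (λ a → subst (_∈ F) (sym (f[c] a)) (G↪F (c∈G a))) ,
  (λ a b a≢b eq → c-distinct a b a≢b (f-injective (trans (sym (f[c] a)) (trans eq (f[c] b))))) ,
  (λ a b → subst₂ (λ p q → (p ⊆ q) ⊎ (q ⊆ p)) (sym (f[c] a)) (sym (f[c] b))
                  (Sum.map f-mono f-mono (c-comparable a b)))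
  where
  f[c] : ∀ a → lookup (Vec.map f c) a ≡ f (lookup c a)
  f[c] a = lookup-map a f c

IsChainIn-∷ : ∀ {n m} {F : Family n} {T : Subset n} {c : Vec (Subset n) m} → T ∈ F →
              (∀ a → lookup c a ⊆ T) → (∀ a → lookup c a ≢ T) → IsChainIn F c → IsChainIn F (T ∷ c)
IsChainIn-∷ {F = F} {T} {c} T∈F c⊆T c≢T (c∈F , c-distinct , c-comparable) = T∷c∈F , distinct , comparable
  where
  T∷c∈F : ∀ a → lookup (T ∷ c) a ∈ F
  T∷c∈F zero    = T∈F
  T∷c∈F (suc a) = c∈F a
  distinct : ∀ a b → a ≢ b → lookup (T ∷ c) a ≢ lookup (T ∷ c) b
  distinct zero    zero    0≢0 = contradiction refl 0≢0
  distinct zero    (suc b) _   = c≢T b ∘ sym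
  distinct (suc a) zero    _   = c≢T a
  distinct (suc a) (suc b) a≢b = c-distinct a b (a≢b ∘ cong suc)
  comparable : ∀ a b → (lookup (T ∷ c) a ⊆ lookup (T ∷ c) b) ⊎ (lookup (T ∷ c) b ⊆ lookup (T ∷ c) a)
  comparable zero    zero    = inj₁ ⊆-refl
  comparable zero    (suc b) = inj₂ (c⊆T b)
  comparable (suc a) zero    = inj₁ (c⊆T a)
  comparable (suc a) (suc b) = c-comparable a b

module _ {n} {F : Family (suc n)} {G : Family n} (x : Fin (suc n)) (G↪F : ∀ {B} → B ∈ G → embed x B ∈ F) where

  NoChainOfSize-embed : ∀ {m} → NoChainOfSize m F → NoChainOfSize m G
  NoChainOfSize-embed noChain c chain =
    noChain (Vec.map (embed x) c) (IsChainIn-map {c = c} (embed x) (embed-injective x) (embed-mono x) G↪F chain)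

  NoChainOfSize-embed-under-⊤ : ∀ {m} → ⊤ ∈ F → NoChainOfSize (suc m) F → NoChainOfSize m G
  NoChainOfSize-embed-under-⊤ ⊤∈F noChain c chain =
    noChain (⊤ ∷ Vec.map (embed x) c)
            (IsChainIn-∷ ⊤∈F (λ _ → ⊆⊤) (λ a → embed≢⊤ x _ ∘ trans (sym (lookup-map a (embed x) c)))
                         (IsChainIn-map {c = c} (embed x) (embed-injective x) (embed-mono x) G↪F chain))

NoChainOfSize1⇒≡[] : ∀ {n} {F : Family n} → NoChainOfSize 1 F → F ≡ []
NoChainOfSize1⇒≡[] {F = []}    _       = refl
NoChainOfSize1⇒≡[] {F = A ∷ F} noChain = ⊥-elim (noChain (A ∷ []) (
  (λ { zero → here refl }) ,
  (λ { zero zero 0≢0 → contradiction refl 0≢0 }) ,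
  (λ { zero zero → inj₁ ⊆-refl })))

-- The LYM inequality

-- n!/C(n, j): the number of maximal chains of 2^[n] through a fixed j-set.
levelWeight : ℕ → ℕ → ℕ
levelWeight n j = j ! * (n ∸ j) !

weight : ∀ {n} → Subset n → ℕ
weight {n} A = levelWeight n ∣ A ∣

totalWeight : ∀ {n} → Family n → ℕ
totalWeight F = sumᴸ (List.map weight F)

sum≤n*c : ∀ {N} {f : Fin N → ℕ} c → (∀ x → f x ≤ c) → sum f ≤ N * c
sum≤n*c {zero}  c f≤c = z≤n
sum≤n*c {suc N} c f≤c = +-mono-≤ (f≤c zero) (sum≤n*c c (f≤c ∘ suc))

sum-outside≡∣∁∣* : ∀ {N} (A : Subset N) c → ∑[ x < N ] (if lookup A x then 0 else c) ≡ ∣ ∁ A ∣ * c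
sum-outside≡∣∁∣* []            c = refl
sum-outside≡∣∁∣* (inside ∷ A)  c = sum-outside≡∣∁∣* A c
sum-outside≡∣∁∣* (outside ∷ A) c = cong (_+_ c) (sum-outside≡∣∁∣* A c)

weight-⊤ : ∀ n → weight (⊤ {suc n}) ≡ suc n !
weight-⊤ n = begin
  weight (⊤ {suc n})           ≡⟨ cong (levelWeight (suc n)) (∣⊤∣≡n (suc n)) ⟩
  suc n ! * (suc n ∸ suc n) !  ≡⟨ cong (λ d → suc n ! * d !) (n∸n≡0 n) ⟩
  suc n ! * 1                  ≡⟨ *-identityʳ (suc n !) ⟩
  suc n !                      ∎
  where open ≡-Reasoning

-- A maximal chain through A ≠ ⊤ passes through exactly one coatom, the complement of some x ∉ A.
weight-removeAt : ∀ {n} (A : Subset (suc n)) → A ≢ ⊤ →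
                  weight A ≡ ∑[ x < suc n ] (if lookup A x then 0 else weight (removeAt A x))
weight-removeAt {n} A A≢⊤ = begin
  a ! * (suc n ∸ a) !                                               ≡⟨ cong (a ! *_) ([n-k]*[n-k-1]!≡[n-k]! a<1+n) ⟨
  a ! * ((suc n ∸ a) * (n ∸ a) !)                                   ≡⟨ *-left-comm (a !) (suc n ∸ a) _ ⟩
  (suc n ∸ a) * levelWeight n a                                     ≡⟨ cong (_* levelWeight n a) (∣∁p∣≡n∸∣p∣ A) ⟨
  ∣ ∁ A ∣ * levelWeight n a                                         ≡⟨ sum-outside≡∣∁∣* A (levelWeight n a) ⟨
  ∑[ x < suc n ] (if lookup A x then 0 else levelWeight n a)        ≡⟨ sum-cong-≗ removeAt-level ⟩
  ∑[ x < suc n ] (if lookup A x then 0 else weight (removeAt A x))  ∎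
  where
  open ≡-Reasoning
  a : ℕ
  a = ∣ A ∣
  a<1+n : a < suc n
  a<1+n = ≤∧≢⇒< (∣p∣≤n A) (A≢⊤ ∘ ∣p∣≡n⇒p≡⊤)
  removeAt-level : ∀ x → (if lookup A x then 0 else levelWeight n a) ≡ (if lookup A x then 0 else weight (removeAt A x))
  removeAt-level x with lookup A x in A[x]≡b
  ... | true  = refl
  ... | false = cong (levelWeight n) (sym (∣removeAt∣ A x A[x]≡b))

module _ {n} (x : Fin (suc n)) where

  avoids? : ∀ A → Dec (lookup A x ≡ outside)
  avoids? A = lookup A x Bool.≟ outside

  shrink : Family (suc n) → Family n
  shrink F = List.map (λ A → removeAt A x) (filter avoids? F)

  ∈-shrink⁻ : ∀ {F B} → B ∈ shrink F → embed x B ∈ F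
  ∈-shrink⁻ {F} B∈ with ∈-map⁻ (λ A → removeAt A x) B∈
  ... | A , A∈filter , refl with ∈-filter⁻ avoids? A∈filter
  ...   | A∈F , A[x]≡outside = subst (_∈ F) (sym (embed-removeAt A x A[x]≡outside)) A∈F

  shrink-unique : ∀ {F} → Unique F → Unique (shrink F)
  shrink-unique {F} F-unique = Unique.map⁻ (subst Unique filter≡embed∘shrink (Unique.filter⁺ avoids? F-unique))
    where
    filter≡embed∘shrink : filter avoids? F ≡ List.map (embed x) (shrink F)
    filter≡embed∘shrink = sym (trans (sym (map-∘ (filter avoids? F)))
                                     (map-id-local (All.map (λ {A} → embed-removeAt A x) (all-filter avoids? F))))

  totalWeight-shrink-∷ : ∀ A F → totalWeight (shrink (A ∷ F)) ≡
                                 (if lookup A x then 0 else weight (removeAt A x)) + totalWeight (shrink F)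
  totalWeight-shrink-∷ A F with lookup A x
  ... | true  = refl
  ... | false = refl

totalWeight-shrink : ∀ {n} (F : Family (suc n)) → ⊤ ∉ F → totalWeight F ≡ ∑[ x < suc n ] totalWeight (shrink x F)
totalWeight-shrink {n} []      _     = sym (sum-replicate-zero (suc n))
totalWeight-shrink {n} (A ∷ F) ⊤∉A∷F = begin
  weight A + totalWeight F
    ≡⟨ cong₂ _+_ (weight-removeAt A (⊤∉A∷F ∘ here ∘ sym)) (totalWeight-shrink F (⊤∉A∷F ∘ there)) ⟩
  ∑[ x < suc n ] wA x + ∑[ x < suc n ] totalWeight (shrink x F)
    ≡⟨ ∑-distrib-+ wA (λ x → totalWeight (shrink x F)) ⟨
  ∑[ x < suc n ] (wA x + totalWeight (shrink x F))
    ≡⟨ sum-cong-≗ (λ x → totalWeight-shrink-∷ x A F) ⟨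
  ∑[ x < suc n ] totalWeight (shrink x (A ∷ F))
    ∎
  where
  open ≡-Reasoning
  wA : Fin (suc n) → ℕ
  wA x = if lookup A x then 0 else weight (removeAt A x)

lym : ∀ {n} k (F : Family n) → Unique F → NoChainOfSize (suc k) F → totalWeight F ≤ k * n !
lym zero F _ noChain rewrite NoChainOfSize1⇒≡[] noChain = z≤n
lym {zero}  (suc k) []            _                 _ = z≤n
lym {zero}  (suc k) ([] ∷ [])     _                 _ = s≤s z≤n
lym {zero}  (suc k) ([] ∷ [] ∷ _) (([]≢[] ∷ _) ∷ _) _ = contradiction refl []≢[]
lym {suc n} (suc k) F F-unique noChain with any? (⊤ ≟ˢ_) F
... | no ⊤∉F = begin
  totalWeight F                            ≡⟨ totalWeight-shrink F ⊤∉F ⟩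
  ∑[ x < suc n ] totalWeight (shrink x F)  ≤⟨ sum≤n*c (suc k * n !) shrunk-bound ⟩
  suc n * (suc k * n !)                    ≡⟨ *-left-comm (suc n) (suc k) (n !) ⟩
  suc k * suc n !                          ∎
  where
  open ≤-Reasoning
  shrunk-bound : ∀ x → totalWeight (shrink x F) ≤ suc k * n !
  shrunk-bound x = lym (suc k) (shrink x F) (shrink-unique x F-unique) (NoChainOfSize-embed x (∈-shrink⁻ x) noChain)
... | yes ⊤∈F = begin
  totalWeight F
    ≡⟨ sum-↭ (↭.map⁺ weight (↭-∖ F-unique ⊤∈F)) ⟩
  weight (⊤ {suc n}) + totalWeight (F ∖ ⊤)
    ≡⟨ cong₂ _+_ (weight-⊤ n) (totalWeight-shrink (F ∖ ⊤) (x∉xs∖x {xs = F})) ⟩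
  suc n ! + ∑[ x < suc n ] totalWeight (shrink x (F ∖ ⊤))
    ≤⟨ +-monoʳ-≤ (suc n !) (sum≤n*c (k * n !) shrunk-bound) ⟩
  suc n ! + suc n * (k * n !)
    ≡⟨ cong (_+_ (suc n !)) (*-left-comm (suc n) k (n !)) ⟩
  suc k * suc n !
    ∎
  where
  open ≤-Reasoning
  shrunk-bound : ∀ x → totalWeight (shrink x (F ∖ ⊤)) ≤ k * n !
  shrunk-bound x = lym k (shrink x (F ∖ ⊤)) (shrink-unique x (∖-unique F-unique))
                       (NoChainOfSize-embed-under-⊤ x (λ B∈ → ∈-∖⁻ {xs = F} (∈-shrink⁻ x B∈)) ⊤∈F noChain)

-- Counting a family level by level

level : ∀ {n} → ℕ → Family n → Family n
level j = filter (λ A → ∣ A ∣ ≟ j)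

∈-level⁻ : ∀ {n} j (F : Family n) {A} → A ∈ level j F → ∣ A ∣ ≡ j
∈-level⁻ j F = proj₂ ∘ ∈-filter⁻ (λ A → ∣ A ∣ ≟ j) {xs = F}

level-antichain : ∀ {n} j (F : Family n) → NoChainOfSize 2 (level j F)
level-antichain j F (A ∷ B ∷ []) (c∈level , c-distinct , c-comparable) = c-distinct zero (suc zero) (λ ()) A≡B
  where
  ∣A∣≡∣B∣ : ∣ A ∣ ≡ ∣ B ∣
  ∣A∣≡∣B∣ = trans (∈-level⁻ j F (c∈level zero)) (sym (∈-level⁻ j F (c∈level (suc zero))))
  A≡B : A ≡ B
  A≡B = [ (λ (A⊆B : A ⊆ B) → p⊆q∧∣p∣≡∣q∣⇒p≡q A⊆B ∣A∣≡∣B∣) ,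
          (λ (B⊆A : B ⊆ A) → sym (p⊆q∧∣p∣≡∣q∣⇒p≡q B⊆A (sym ∣A∣≡∣B∣))) ]
        (c-comparable zero (suc zero))

totalWeight-level : ∀ {n} j (F : Family n) → totalWeight (level j F) ≡ length (level j F) * levelWeight n j
totalWeight-level {n} j F = constant-weight (all-filter (λ A → ∣ A ∣ ≟ j) F)
  where
  constant-weight : ∀ {L : Family n} → All (λ A → ∣ A ∣ ≡ j) L → totalWeight L ≡ length L * levelWeight n j
  constant-weight []           = refl
  constant-weight (refl ∷ L≡j) = cong (_+_ (levelWeight n j)) (constant-weight L≡j)

length-level≤nCj : ∀ {n} j (F : Family n) → Unique F → j ≤ n → length (level j F) ≤ n C j
length-level≤nCj {n} j F F-unique j≤n = *-cancelʳ-≤ _ _ (levelWeight n j) {{j !* (n ∸ j) !≢0}} (begin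
  length (level j F) * levelWeight n j  ≡⟨ totalWeight-level j F ⟨
  totalWeight (level j F)               ≤⟨ lym 1 (level j F) (Unique.filter⁺ _ F-unique) (level-antichain j F) ⟩
  1 * n !                               ≡⟨ *-identityˡ (n !) ⟩
  n !                                   ≡⟨ nCk*k![n∸k]!≡n! j≤n ⟨
  (n C j) * levelWeight n j             ∎)
  where open ≤-Reasoning

sum-by-level : ∀ {n} (h : ℕ → ℕ) (F : Family n) →
               sumᴸ (List.map (h ∘ ∣_∣) F) ≡ ∑ℕ[ j < suc n ] (length (level j F) * h j)
sum-by-level {n} h []      = sym (sumBelow-zero (suc n) (λ _ → refl))
sum-by-level {n} h (A ∷ F) = begin
  h ∣ A ∣ + sumᴸ (List.map (h ∘ ∣_∣) F)
    ≡⟨ cong₂ _+_ (sumBelow-indicator h (s≤s (∣p∣≤n A))) (sym (sum-by-level h F)) ⟨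
  ∑ℕ[ j < suc n ] (if does (∣ A ∣ ≟ j) then h j else 0) + ∑ℕ[ j < suc n ] (length (level j F) * h j)
    ≡⟨ sumBelow-distrib-+ (suc n) _ _ ⟨
  ∑ℕ[ j < suc n ] ((if does (∣ A ∣ ≟ j) then h j else 0) + length (level j F) * h j)
    ≡⟨ sumBelow-cong (suc n) (λ {j} _ → level-∷ j) ⟩
  ∑ℕ[ j < suc n ] (length (level j (A ∷ F)) * h j)
    ∎
  where
  open ≡-Reasoning
  -- ℕ's _≟_ decides through _≡ᵇ_, and that is the test filter gets stuck on.
  level-∷ : ∀ j → (if does (∣ A ∣ ≟ j) then h j else 0) + length (level j F) * h j ≡
                  length (level j (A ∷ F)) * h j
  level-∷ j with ∣ A ∣ ≡ᵇ j
  ... | true  = refl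
  ... | false = refl

length-by-level : ∀ {n} (F : Family n) → length F ≡ ∑ℕ[ j < suc n ] length (level j F)
length-by-level {n} F =
  trans (length≡sum-map-1 F) (trans (sum-by-level (λ _ → 1) F) (sumBelow-cong (suc n) (λ _ → *-identityʳ _)))
  where
  length≡sum-map-1 : ∀ (xs : Family n) → length xs ≡ sumᴸ (List.map (λ _ → 1) xs)
  length≡sum-map-1 []       = refl
  length≡sum-map-1 (x ∷ xs) = cong suc (length≡sum-map-1 xs)

c*g≤m*g+c*[c∸m] : ∀ {c g} m → g ≤ c → c * g ≤ m * g + c * (c ∸ m)
c*g≤m*g+c*[c∸m] {c} {g} m g≤c with ≤-total c m
... | inj₁ c≤m = ≤-trans (*-monoˡ-≤ g c≤m) (m≤m+n (m * g) _)
... | inj₂ m≤c = begin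
  c * g                ≡⟨ cong (_* g) (m+[n∸m]≡n m≤c) ⟨
  (m + (c ∸ m)) * g    ≡⟨ *-distribʳ-+ g m (c ∸ m) ⟩
  m * g + (c ∸ m) * g  ≤⟨ +-monoʳ-≤ (m * g) (*-monoʳ-≤ (c ∸ m) g≤c) ⟩
  m * g + (c ∸ m) * c  ≡⟨ cong (_+_ (m * g)) (*-comm (c ∸ m) c) ⟩
  m * g + c * (c ∸ m)  ∎
  where open ≤-Reasoning

c*v*g≤m*[g*v]+c*v*[c∸m] : ∀ {c g} m v → g ≤ c → c * v * g ≤ m * (g * v) + c * v * (c ∸ m)
c*v*g≤m*[g*v]+c*v*[c∸m] {c} {g} m v g≤c = begin
  c * v * g                      ≡⟨ c*v*g≡c*g*v c v g ⟩
  c * g * v                      ≤⟨ *-monoˡ-≤ v (c*g≤m*g+c*[c∸m] m g≤c) ⟩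
  (m * g + c * (c ∸ m)) * v      ≡⟨ [m*g+c*d]*v≡m*[g*v]+c*v*d m g c (c ∸ m) v ⟩
  m * (g * v) + c * v * (c ∸ m)  ∎
  where
  open ≤-Reasoning
  c*v*g≡c*g*v : ∀ c v g → c * v * g ≡ c * g * v
  c*v*g≡c*g*v = solve-∀
  [m*g+c*d]*v≡m*[g*v]+c*v*d : ∀ m g c d v → (m * g + c * d) * v ≡ m * (g * v) + c * v * d
  [m*g+c*d]*v≡m*[g*v]+c*v*d = solve-∀

count-bound : ∀ {n} m (G : Family n) → Unique G →
              n ! * length G ≤ m * totalWeight G + n ! * ∑ℕ[ j < suc n ] ((n C j) ∸ m)
count-bound {n} m G G-unique = begin
  n ! * length G
    ≡⟨ cong (n ! *_) (length-by-level G) ⟩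
  n ! * ∑ℕ[ j < suc n ] g j
    ≡⟨ *-distribˡ-sumBelow (suc n) (n !) g ⟩
  ∑ℕ[ j < suc n ] (n ! * g j)
    ≤⟨ sumBelow-mono-≤ (suc n) (λ j<1+n → at-level (≤-pred j<1+n)) ⟩
  ∑ℕ[ j < suc n ] (m * (g j * levelWeight n j) + n ! * ((n C j) ∸ m))
    ≡⟨ sumBelow-distrib-+ (suc n) _ _ ⟩
  ∑ℕ[ j < suc n ] (m * (g j * levelWeight n j)) + ∑ℕ[ j < suc n ] (n ! * ((n C j) ∸ m))
    ≡⟨ cong₂ _+_ (*-distribˡ-sumBelow (suc n) m _) (*-distribˡ-sumBelow (suc n) (n !) _) ⟨
  m * ∑ℕ[ j < suc n ] (g j * levelWeight n j) + n ! * ∑ℕ[ j < suc n ] ((n C j) ∸ m)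
    ≡⟨ cong (λ w → m * w + _) (sum-by-level (levelWeight n) G) ⟨
  m * totalWeight G + n ! * ∑ℕ[ j < suc n ] ((n C j) ∸ m)
    ∎
  where
  open ≤-Reasoning
  g : ℕ → ℕ
  g j = length (level j G)
  at-level : ∀ {j} → j ≤ n → n ! * g j ≤ m * (g j * levelWeight n j) + n ! * ((n C j) ∸ m)
  at-level {j} j≤n = subst (λ N → N * g j ≤ m * (g j * levelWeight n j) + N * ((n C j) ∸ m)) (nCk*k![n∸k]!≡n! j≤n)
                           (c*v*g≤m*[g*v]+c*v*[c∸m] m (levelWeight n j) (length-level≤nCj j G G-unique j≤n))

count-bound-∈ : ∀ {n} m (F : Family n) → Unique F → ∀ {A} → A ∈ F →
                n ! * length F + m * weight A ≤ m * totalWeight F + n ! * (∑ℕ[ j < suc n ] ((n C j) ∸ m) + 1)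
count-bound-∈ {n} m F F-unique {A} A∈F = begin
  n ! * length F + m * weight A
    ≡⟨ cong (λ l → n ! * l + m * weight A) (↭.↭-length F↭A∷F∖A) ⟩
  n ! * suc (length (F ∖ A)) + m * weight A
    ≡⟨ N*[1+f]+x≡N*f+[N+x] (n !) (length (F ∖ A)) (m * weight A) ⟩
  n ! * length (F ∖ A) + (n ! + m * weight A)
    ≤⟨ +-monoˡ-≤ _ (count-bound m (F ∖ A) (∖-unique F-unique)) ⟩
  m * totalWeight (F ∖ A) + n ! * d + (n ! + m * weight A)
    ≡⟨ m*W+N*d+[N+m*w]≡m*[w+W]+N*[d+1] m (totalWeight (F ∖ A)) (n !) d (weight A) ⟩
  m * (weight A + totalWeight (F ∖ A)) + n ! * (d + 1)
    ≡⟨ cong (λ w → m * w + n ! * (d + 1)) (sum-↭ (↭.map⁺ weight F↭A∷F∖A)) ⟨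
  m * totalWeight F + n ! * (d + 1)
    ∎
  where
  open ≤-Reasoning
  F↭A∷F∖A : F ↭ A ∷ (F ∖ A)
  F↭A∷F∖A = ↭-∖ F-unique A∈F
  d : ℕ
  d = ∑ℕ[ j < suc n ] ((n C j) ∸ m)
  N*[1+f]+x≡N*f+[N+x] : ∀ N f x → N * suc f + x ≡ N * f + (N + x)
  N*[1+f]+x≡N*f+[N+x] = solve-∀
  m*W+N*d+[N+m*w]≡m*[w+W]+N*[d+1] : ∀ m W N d w → m * W + N * d + (N + m * w) ≡ m * (w + W) + N * (d + 1)
  m*W+N*d+[N+m*w]≡m*[w+W]+N*[d+1] = solve-∀

-- The k middle binomial coefficients

-- Σ(n, k) adds up the levels L + 1, …, L + k for L = lowIdx n k: a window centred in [0, n]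
-- when k ≤ n, and one covering all of [0, n] (with L < 0) when k > n.
data Window (n k : ℕ) : ℤ → Set where
  centred  : ∀ l → l + l + k ≤ n → n ≤ suc (l + l + k) → Window n k (+ l)
  covering : ∀ q → q + suc n ≤ k → Window n k -[1+ q ]

-[1+p]/ℕ2 : ∀ p → ∃ λ q → -[1+ p ] /ℕ 2 ≡ -[1+ q ] × q ≤ p
-[1+p]/ℕ2 zero = 0 , refl , z≤n
-[1+p]/ℕ2 (suc p) with suc (suc p) % 2
... | zero  = p / 2 , cong (ℤ.-_ ∘ +_) (m/n≡1+[m∸n]/n {suc (suc p)} {2} (s≤s (s≤s z≤n))) ,
              m≤n⇒m≤1+n (m/n≤m p 2)
... | suc _ = suc (suc p) / 2 , refl , ≤-pred (m/n<m (suc (suc p)) 2 (s≤s (s≤s z≤n)))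

lowIdx-window : ∀ n k → Window n k (lowIdx n k)
lowIdx-window n k with k ≤? n
... | yes k≤n = subst (Window n k) (sym lowIdx≡+l) (centred l l+l+k≤n n≤1+l+l+k)
  where
  d l : ℕ
  d = n ∸ k
  l = d / 2
  lowIdx≡+l : lowIdx n k ≡ + l
  lowIdx≡+l = cong (_/ℕ 2) (trans (m-n≡m⊖n n k) (⊖-≥ k≤n))
  l+l≡l*2 : l + l ≡ l * 2
  l+l≡l*2 = trans (cong (λ x → l + x) (sym (*-identityʳ l))) (sym (*-suc l 1))
  l+l+k≤n : l + l + k ≤ n
  l+l+k≤n = ≤-trans (+-monoˡ-≤ k (≤-trans (≤-reflexive l+l≡l*2) (m/n*n≤m d 2))) (≤-reflexive (m∸n+n≡m k≤n))
  n≤1+l+l+k : n ≤ suc (l + l + k)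
  n≤1+l+l+k = begin
    n                  ≡⟨ m∸n+n≡m k≤n ⟨
    d + k              ≡⟨ cong (_+ k) (m≡m%n+[m/n]*n d 2) ⟩
    d % 2 + l * 2 + k  ≤⟨ +-monoˡ-≤ k (+-mono-≤ (≤-pred (m%n<n d 2)) (≤-reflexive (sym l+l≡l*2))) ⟩
    suc (l + l + k)    ∎
    where open ≤-Reasoning
lowIdx-window n zero    | no 0≰n = contradiction z≤n 0≰n
lowIdx-window n (suc k) | no 1+k≰n with -[1+p]/ℕ2 (k ∸ n)
... | q , -[1+k∸n]/2≡-[1+q] , q≤k∸n = subst (Window n (suc k)) (sym lowIdx≡-[1+q]) (covering q q+1+n≤1+k)
  where
  n≤k : n ≤ k
  n≤k = ≤-pred (≰⇒> 1+k≰n)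
  lowIdx≡-[1+q] : lowIdx n (suc k) ≡ -[1+ q ]
  lowIdx≡-[1+q] =
    trans (cong (_/ℕ 2) (trans (m-n≡m⊖n n (suc k)) (trans (⊖-< (s≤s n≤k)) (cong (ℤ.-_ ∘ +_) (+-∸-assoc 1 n≤k)))))
          -[1+k∸n]/2≡-[1+q]
  q+1+n≤1+k : q + suc n ≤ suc k
  q+1+n≤1+k = ≤-trans (+-monoˡ-≤ (suc n) q≤k∸n) (≤-reflexive (trans (+-suc (k ∸ n) n) (cong suc (m∸n+n≡m n≤k))))

window-centred : ∀ {n k} l → l + l + k ≤ n → n ≤ suc (l + l + k) →
                 ∑ℕ[ j < suc n ] ((n C j) ∸ (n C l)) + k * (n C l) ≡ ∑ℕ[ s < k ] (n C (l + suc s))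
window-centred {n} {k} l l+l+k≤n n≤1+l+l+k = begin
  ∑ℕ[ j < suc n ] ((n C j) ∸ m) + k * m
    ≡⟨ cong₂ _+_ (sumBelow-window (suc l) k (s≤s l+k≤n) off-window) (sym (sumBelow-const k m)) ⟩
  ∑ℕ[ s < k ] ((n C (suc l + s)) ∸ m) + ∑ℕ[ s < k ] m
    ≡⟨ sumBelow-distrib-+ k _ _ ⟨
  ∑ℕ[ s < k ] ((n C (suc l + s)) ∸ m + m)
    ≡⟨ sumBelow-cong k (λ s<k → trans (m∸n+n≡m (in-window s<k)) (cong (n C_) (sym (+-suc l _)))) ⟩
  ∑ℕ[ s < k ] (n C (l + suc s))
    ∎
  where
  open ≡-Reasoning
  m : ℕ
  m = n C l
  l+[1+l+x]≡1+[l+l+x] : ∀ l x → l + (suc l + x) ≡ suc (l + l + x)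
  l+[1+l+x]≡1+[l+l+x] = solve-∀
  l+k≤n : l + k ≤ n
  l+k≤n = ≤-trans (+-monoˡ-≤ k (m≤n+m l l)) l+l+k≤n
  off-window : ∀ {j} → j < suc n → j < suc l ⊎ suc l + k ≤ j → (n C j) ∸ m ≡ 0
  off-window {j} _ (inj₁ (s≤s j≤l)) =
    m≤n⇒m∸n≡0 (nCa≤nCb j≤l (≤-trans (+-monoˡ-≤ l j≤l) (≤-trans (m≤m+n (l + l) k) l+l+k≤n)))
  off-window {j} (s≤s j≤n) (inj₂ 1+l+k≤j) =
    m≤n⇒m∸n≡0 (nCb≤nCa (≤-trans (m≤m+n l k) (≤-trans (n≤1+n _) 1+l+k≤j)) j≤n
                       (≤-trans n≤1+l+l+k (≤-trans (≤-reflexive (sym (l+[1+l+x]≡1+[l+l+x] l k)))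
                                                   (+-monoʳ-≤ l 1+l+k≤j))))
  in-window : ∀ {s} → s < k → m ≤ n C (suc l + s)
  in-window {s} s<k =
    nCa≤nCb (≤-trans (n≤1+n l) (m≤m+n (suc l) s))
            (≤-trans (≤-reflexive (l+[1+l+x]≡1+[l+l+x] l s)) (≤-trans (+-monoʳ-< (l + l) s<k) l+l+k≤n))

window-covering : ∀ {n k} q → q + suc n ≤ k →
                  ∑ℕ[ j < suc n ] (n C j) ≤ ∑ℕ[ s < k ] binomℤ n (-[1+ q ] ℤ.+ + suc s)
window-covering {n} {k} q q+1+n≤k = begin
  ∑ℕ[ j < suc n ] (n C j)                   ≡⟨ sumBelow-cong (suc n) (λ {j} _ → cong (binomℤ n) (shift j)) ⟨
  ∑ℕ[ j < suc n ] σ (q + j)                 ≤⟨ m≤n+m _ (sumBelow q σ) ⟩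
  sumBelow q σ + ∑ℕ[ j < suc n ] σ (q + j)  ≡⟨ sumBelow-split q (suc n) σ ⟨
  sumBelow (q + suc n) σ                    ≤⟨ sumBelow-mono-range σ q+1+n≤k ⟩
  sumBelow k σ                              ∎
  where
  open ≤-Reasoning
  σ : ℕ → ℕ
  σ s = binomℤ n (-[1+ q ] ℤ.+ + suc s)
  shift : ∀ j → -[1+ q ] ℤ.+ + suc (q + j) ≡ + j
  shift j = trans ([1+m]⊖[1+n]≡m⊖n (q + j) q) (trans (⊖-≥ (m≤m+n q j)) (cong +_ (m+n∸m≡n q j)))

Σsum≡sumBelow : ∀ n k t → Σsum n k t ≡ ∑ℕ[ s < t ] binomℤ n (lowIdx n k ℤ.+ + suc s)
Σsum≡sumBelow n k zero    = refl
Σsum≡sumBelow n k (suc t) = cong (_+ binomℤ n (lowIdx n k ℤ.+ + suc t)) (Σsum≡sumBelow n k t)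

binomial-window : ∀ n k → ∑ℕ[ j < suc n ] ((n C j) ∸ binomℤ n (lowIdx n k)) + k * binomℤ n (lowIdx n k) ≤ Σ n k
binomial-window n k = subst (excess (lowIdx n k) ≤_) (sym (Σsum≡sumBelow n k k)) (within (lowIdx-window n k))
  where
  excess : ℤ → ℕ
  excess L = ∑ℕ[ j < suc n ] ((n C j) ∸ binomℤ n L) + k * binomℤ n L
  within : ∀ {L} → Window n k L → excess L ≤ ∑ℕ[ s < k ] binomℤ n (L ℤ.+ + suc s)
  within (centred l l+l+k≤n n≤1+l+l+k) = ≤-reflexive (window-centred l l+l+k≤n n≤1+l+l+k)
  within (covering q q+1+n≤k)          = begin
    ∑ℕ[ j < suc n ] (n C j) + k * 0                  ≡⟨ cong (_+_ (∑ℕ[ j < suc n ] (n C j))) (*-zeroʳ k) ⟩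
    ∑ℕ[ j < suc n ] (n C j) + 0                      ≡⟨ +-identityʳ _ ⟩
    ∑ℕ[ j < suc n ] (n C j)                          ≤⟨ window-covering q q+1+n≤k ⟩
    ∑ℕ[ s < k ] binomℤ n (-[1+ q ] ℤ.+ + suc s)      ∎
    where open ≤-Reasoning

corollary3p5 : (n k i : ℕ) → 1 ≤ k → (F : Family n) → Unique F →
    NoChainOfSize (suc k) F →
    (A : Subset n) → A ∈ F → ∣ A ∣ ≡ i → 2 * i < n →
    length F * (n C i) + binomℤ n (lowIdx n k) ≤ (Σ n k + 1) * (n C i)
corollary3p5 n k i _ F F-unique noChain A A∈F refl 2i<n = *-cancelʳ-≤ _ _ (weight A) {{i !* (n ∸ i) !≢0}} (begin
  (length F * (n C i) + m) * weight A              ≡⟨ [f*c+m]*v≡c*v*f+m*v (length F) (n C i) m (weight A) ⟩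
  (n C i) * weight A * length F + m * weight A     ≡⟨ cong (λ N → N * length F + m * weight A) c*v≡n! ⟩
  n ! * length F + m * weight A                    ≤⟨ count-bound-∈ m F F-unique A∈F ⟩
  m * totalWeight F + n ! * (d + 1)                ≤⟨ +-monoˡ-≤ _ (*-monoʳ-≤ m (lym k F F-unique noChain)) ⟩
  m * (k * n !) + n ! * (d + 1)                    ≡⟨ m*[k*N]+N*[d+1]≡N*[d+k*m]+N m k (n !) d ⟩
  n ! * (d + k * m) + n !                          ≤⟨ +-monoˡ-≤ (n !) (*-monoʳ-≤ (n !) (binomial-window n k)) ⟩
  n ! * Σ n k + n !                                ≡⟨ cong (λ N → N * Σ n k + N) c*v≡n! ⟨
  (n C i) * weight A * Σ n k + (n C i) * weight A  ≡⟨ c*v*S+c*v≡[S+1]*c*v (Σ n k) (n C i) (weight A) ⟩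
  (Σ n k + 1) * (n C i) * weight A                 ∎)
  where
  open ≤-Reasoning
  m d : ℕ
  m = binomℤ n (lowIdx n k)
  d = ∑ℕ[ j < suc n ] ((n C j) ∸ m)
  c*v≡n! : (n C i) * weight A ≡ n !
  c*v≡n! = nCk*k![n∸k]!≡n! (≤-trans (m≤m+n i (i + 0)) (<⇒≤ 2i<n))
  [f*c+m]*v≡c*v*f+m*v : ∀ f c m v → (f * c + m) * v ≡ c * v * f + m * v
  [f*c+m]*v≡c*v*f+m*v = solve-∀
  m*[k*N]+N*[d+1]≡N*[d+k*m]+N : ∀ m k N d → m * (k * N) + N * (d + 1) ≡ N * (d + k * m) + N
  m*[k*N]+N*[d+1]≡N*[d+k*m]+N = solve-∀
  c*v*S+c*v≡[S+1]*c*v : ∀ S c v → c * v * S + c * v ≡ (S + 1) * c * v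
  c*v*S+c*v≡[S+1]*c*v = solve-∀
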